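{- Let $t,\ell,\lambda,m$ be integers with $t>\ell\ge0$, $\lambda\ge1$ and $m>t+\ell+\lambda+2$. Let $A$ be an $m$-rowed $(0,1)$-matrix with $(\lambda+2)\cdot{\bf 1}_t{\bf 0}_\ell\not\prec A$, all column sums in $\{t,\dots,m-\ell\}$ and no repeated column of sum $t$. Let $A_{t+1}$ be the submatrix of columns of $A$ of column sum $t+1$, and for a set of rows $R\subseteq[m]$ let $A^R_{t+1}$ be the submatrix of $A_{t+1}$ formed by the columns having a $1$ in at least one row of $R$. Then $$\|A^R_{t+1}\|\le|R|\cdot\frac{\lambda+1}{t}\binom{m-1}{t-1}.$$
   Context: $\|\cdot\|$ denotes number of columns counted with multiplicity. ${\bf 1}_t{\bf 0}_\ell$ is the column of $t$ ones above $\ell$ zeros, $q\cdot{\bf v}$ is $q$ copies of ${\bf v}$, and $F\prec A$ means some submatrix of $A$ is a row and column permutation of $F$. -}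

module Defs where

open import Data.Nat using (ℕ; zero; suc; _+_; _<ᵇ_; _≡ᵇ_)
open import Data.Bool using (Bool; true; false; if_then_else_; _∧_; _∨_)
open import Data.Fin using (Fin; zero; suc; toℕ)
open import Data.Fin.Subset using (Subset)
open import Data.Vec using (lookup)
open import Data.Product using (∃; ∃-syntax; _×_)
open import Function.Definitions using (Injective)
open import Relation.Binary.PropositionalEquality using (_≡_)

Matrix : ℕ → ℕ → Set
Matrix m n = Fin m → Fin n → Bool

count : {n : ℕ} → (Fin n → Bool) → ℕ
count {zero} f = 0
count {suc n} f = (if f zero then 1 else 0) + count (λ k → f (suc k))

any : {n : ℕ} → (Fin n → Bool) → Bool
any {zero} f = false
any {suc n} f = f zero ∨ any (λ k → f (suc k))

colSum : {m n : ℕ} → Matrix m n → Fin n → ℕ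
colSum A j = count (λ i → A i j)

_≺_ : {p q m n : ℕ} → Matrix p q → Matrix m n → Set
_≺_ {p} {q} {m} {n} F A =
  ∃[ r ] ∃[ c ] (Injective _≡_ _≡_ r × Injective _≡_ _≡_ c ×
    (∀ (i : Fin p) (j : Fin q) → A (r i) (c j) ≡ F i j))

copiesOnesZeros : (q t ℓ : ℕ) → Matrix (t + ℓ) q
copiesOnesZeros q t ℓ i j = toℕ i <ᵇ t

normAR : {m n : ℕ} → Matrix m n → ℕ → Subset m → ℕ
normAR {m} {n} A t R =
  count (λ j → (colSum A j ≡ᵇ suc t) ∧ any (λ i → lookup R i ∧ A i j))

-- Every column of A^R_{t+1} has a 1 in some row of R, so ‖A^R_{t+1}‖ is at most the sum over
-- r ∈ R of the number d_r of columns of sum t+1 with a 1 in row r. To bound d_r, double count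
-- the pairs (U, j) where U is a t-set of rows containing r and j is a column of sum t+1
-- containing U: each such column contains exactly t of these sets, while a t-set U lies in at
-- most λ+1 columns of sum t+1. Indeed λ+2 such columns cover at most t+λ+2 rows, so U together
-- with ℓ rows outside them would exhibit (λ+2)·1_t0_ℓ. Hence d_r·t ≤ (λ+1)·C(m−1, t−1).
module Submission where

open import Defs
open import Data.Bool using (Bool; true; false; if_then_else_; _∧_; _∨_; not; T)
open import Data.Bool.Properties using (∧-zeroʳ; ∧-identityʳ; ∨-zeroʳ; T-≡; T-not-≡; T-∧; T-∨)
open import Data.Fin using (Fin; zero; suc; toℕ; splitAt; join)
import Data.Fin.Properties as Fin
open import Data.Fin.Subset using (Subset; ∣_∣)
open import Data.Nat
  using (ℕ; zero; suc; _+_; _*_; _∸_; _≤_; _<_; z≤n; s≤s; s≤s⁻¹; z<s; _≡ᵇ_; _<ᵇ_; _≤?_)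
open import Data.Nat.Properties
open import Data.Nat.Combinatorics using (_C_; k>n⇒nCk≡0; nCk+nC[k+1]≡[n+1]C[k+1]; nCk≡nC[n∸k]; nC1≡n)
open import Algebra.Properties.Semiring.Sum +-*-semiring
  using (sum-syntax; sum-cong-≗; sum-replicate-zero; ∑-comm; ∑-distrib-+; *-distribˡ-sum; *-distribʳ-sum)
open import Data.Product using (Σ-syntax; _×_; _,_; proj₁; proj₂)
open import Data.Sum using (inj₁; inj₂; [_,_]′)
import Data.Vec as Vec
open import Data.Vec.Functional using (_∷_)
open import Function using (_∘_; id; Equivalence)
open import Function.Definitions using (Injective)
open import Relation.Binary.PropositionalEquality
open import Relation.Nullary using (¬_; yes; no; contradiction)

open Equivalence using (to; from)

𝟙 : Bool → ℕ
𝟙 b = if b then 1 else 0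

count≡∑𝟙 : ∀ {n} (f : Fin n → Bool) → count f ≡ ∑[ i < n ] 𝟙 (f i)
count≡∑𝟙 {zero}  f = refl
count≡∑𝟙 {suc n} f = cong (𝟙 (f zero) +_) (count≡∑𝟙 (f ∘ suc))

∑-mono-≤ : ∀ {n} {f g : Fin n → ℕ} → (∀ i → f i ≤ g i) → ∑[ i < n ] f i ≤ ∑[ i < n ] g i
∑-mono-≤ {zero}  f≤g = z≤n
∑-mono-≤ {suc n} f≤g = +-mono-≤ (f≤g zero) (∑-mono-≤ (f≤g ∘ suc))

count-cong : ∀ {n} {f g : Fin n → Bool} → (∀ i → f i ≡ g i) → count f ≡ count g
count-cong {zero}  f≡g = refl
count-cong {suc n} f≡g = cong₂ (λ b c → 𝟙 b + c) (f≡g zero) (count-cong (f≡g ∘ suc))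

count-mono : ∀ {n} {f g : Fin n → Bool} → (∀ i → T (f i) → T (g i)) → count f ≤ count g
count-mono {zero} f⇒g = z≤n
count-mono {suc n} {f} {g} f⇒g with f zero | g zero | f⇒g zero
... | false | false | _      = count-mono (f⇒g ∘ suc)
... | false | true  | _      = m≤n⇒m≤1+n (count-mono (f⇒g ∘ suc))
... | true  | true  | _      = s≤s (count-mono (f⇒g ∘ suc))
... | true  | false | f₀⇒g₀ = contradiction _ f₀⇒g₀

count-false : ∀ n → count {n} (λ _ → false) ≡ 0
count-false zero    = refl
count-false (suc n) = count-false n

count-true : ∀ n → count {n} (λ _ → true) ≡ n
count-true zero    = refl
count-true (suc n) = cong suc (count-true n)

count-pos : ∀ {n} (f : Fin n → Bool) k → T (f k) → 0 < count f
count-pos f zero fₖ with f zero | fₖ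
... | true | _ = s≤s z≤n
count-pos f (suc k) fₖ with f zero
... | true  = s≤s z≤n
... | false = count-pos (f ∘ suc) k fₖ

count-∧ˡ : ∀ {n} b (f : Fin n → Bool) → count (λ i → b ∧ f i) ≡ 𝟙 b * count f
count-∧ˡ true  f = sym (+-identityʳ (count f))
count-∧ˡ {n} false f = count-false n

count-split : ∀ {n} (U S : Fin n → Bool) →
  count S ≡ count (λ i → U i ∧ S i) + count (λ i → not (U i) ∧ S i)
count-split {zero}  U S = refl
count-split {suc n} U S with U zero | S zero
... | true  | true  = cong suc (count-split (U ∘ suc) (S ∘ suc))
... | true  | false = count-split (U ∘ suc) (S ∘ suc)
... | false | true  = trans (cong suc (count-split (U ∘ suc) (S ∘ suc))) (sym (+-suc _ _))
... | false | false = count-split (U ∘ suc) (S ∘ suc)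

count-complement : ∀ {n} (f : Fin n → Bool) → count f + count (λ i → not (f i)) ≡ n
count-complement {zero}  f = refl
count-complement {suc n} f with f zero
... | true  = cong suc (count-complement (f ∘ suc))
... | false = trans (+-suc _ _) (cong suc (count-complement (f ∘ suc)))

any-intro : ∀ {n} (f : Fin n → Bool) k → T (f k) → T (any f)
any-intro f zero    fₖ = from T-∨ (inj₁ fₖ)
any-intro f (suc k) fₖ = from T-∨ (inj₂ (any-intro (f ∘ suc) k fₖ))

not-any : ∀ {n} (f : Fin n → Bool) k → T (not (any f)) → T (not (f k))
not-any f zero h with f zero | h
... | false | _ = _
not-any f (suc k) h with f zero | h
... | false | h′ = not-any (f ∘ suc) k h′

𝟙-any≤count : ∀ {n} (f : Fin n → Bool) → 𝟙 (any f) ≤ count f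
𝟙-any≤count {zero}  f = z≤n
𝟙-any≤count {suc n} f with f zero
... | true  = s≤s z≤n
... | false = 𝟙-any≤count (f ∘ suc)

count-any≤∑count : ∀ {p n} (F : Fin p → Fin n → Bool) →
  count (λ j → any (λ i → F i j)) ≤ ∑[ i < p ] count (F i)
count-any≤∑count {p} {n} F = begin
  count (λ j → any (λ i → F i j))  ≡⟨ count≡∑𝟙 (λ j → any (λ i → F i j)) ⟩
  ∑[ j < n ] 𝟙 (any (λ i → F i j)) ≤⟨ ∑-mono-≤ (λ j → 𝟙-any≤count (λ i → F i j)) ⟩
  ∑[ j < n ] count (λ i → F i j)   ≡⟨ sum-cong-≗ (λ j → count≡∑𝟙 (λ i → F i j)) ⟩
  ∑[ j < n ] ∑[ i < p ] 𝟙 (F i j)  ≡⟨ ∑-comm (λ j i → 𝟙 (F i j)) ⟩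
  ∑[ i < p ] ∑[ j < n ] 𝟙 (F i j)  ≡⟨ sum-cong-≗ (λ i → count≡∑𝟙 (F i)) ⟨
  ∑[ i < p ] count (F i)           ∎
  where open ≤-Reasoning

Selection : ∀ {n} → (Fin n → Bool) → ℕ → Set
Selection {n} P k = Σ[ f ∈ (Fin k → Fin n) ] Injective _≡_ _≡_ f × (∀ a → T (P (f a)))

selection-suc : ∀ {n k} {P : Fin (suc n) → Bool} → Selection (P ∘ suc) k → Selection P k
selection-suc (f , f-inj , Pf) = suc ∘ f , f-inj ∘ Fin.suc-injective , Pf

selection-zero : ∀ {n k} {P : Fin (suc n) → Bool} → T (P zero) → Selection (P ∘ suc) k →
  Selection P (suc k)
selection-zero P₀ (f , f-inj , Pf) = zero ∷ suc ∘ f , inj , λ { zero → P₀ ; (suc a) → Pf a }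
  where
  inj : Injective _≡_ _≡_ (zero ∷ suc ∘ f)
  inj {zero}  {zero}  _ = refl
  inj {suc a} {suc b} e = cong suc (f-inj (Fin.suc-injective e))
  inj {zero}  {suc b} ()
  inj {suc a} {zero}  ()

selection : ∀ {n} (P : Fin n → Bool) {k} → k ≤ count P → Selection P k
selection P {zero} _ = (λ ()) , (λ {a} → contradiction a Fin.¬Fin0) , (λ ())
selection {suc n} P {suc k} k≤ with P zero in P₀
... | true  = selection-zero {P = P} (from T-≡ P₀) (selection (P ∘ suc) (s≤s⁻¹ k≤))
... | false = selection-suc {P = P} (selection (P ∘ suc) k≤)

[,]-injective : ∀ {A B C : Set} {f : A → C} {g : B → C} →
  Injective _≡_ _≡_ f → Injective _≡_ _≡_ g → (∀ x y → f x ≢ g y) →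
  Injective _≡_ _≡_ [ f , g ]′
[,]-injective f-inj g-inj f≢g {inj₁ x} {inj₁ y} e = cong inj₁ (f-inj e)
[,]-injective f-inj g-inj f≢g {inj₁ x} {inj₂ y} e = contradiction e (f≢g x y)
[,]-injective f-inj g-inj f≢g {inj₂ x} {inj₁ y} e = contradiction (sym e) (f≢g y x)
[,]-injective f-inj g-inj f≢g {inj₂ x} {inj₂ y} e = cong inj₂ (g-inj e)

m+n≮ᵇm : ∀ m n → (m + n <ᵇ m) ≡ false
m+n≮ᵇm zero    n = refl
m+n≮ᵇm (suc m) n = m+n≮ᵇm m n

[1+n]Cn≡1+n : ∀ n → suc n C n ≡ suc n
[1+n]Cn≡1+n n = begin
  suc n C n           ≡⟨ nCk≡nC[n∸k] (n≤1+n n) ⟩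
  suc n C (suc n ∸ n) ≡⟨ cong (suc n C_) (m+n∸n≡m 1 n) ⟩
  suc n C 1           ≡⟨ nC1≡n (suc n) ⟩
  suc n               ∎
  where open ≡-Reasoning

pascal-pred : ∀ {n} k → 0 < n → (n ∸ 1) C suc k + (n ∸ 1) C k ≡ n C suc k
pascal-pred {suc n} k _ = trans (+-comm (n C suc k) (n C k)) (nCk+nC[k+1]≡[n+1]C[k+1] n k)

infix 4 _⊆ᵇ_

_⊆ᵇ_ : ∀ {m} → (Fin m → Bool) → (Fin m → Bool) → Bool
_⊆ᵇ_ {zero}  U S = true
_⊆ᵇ_ {suc m} U S = (not (U zero) ∨ S zero) ∧ (U ∘ suc ⊆ᵇ S ∘ suc)

⊆ᵇ-sound : ∀ {m} {U S : Fin m → Bool} → T (U ⊆ᵇ S) → ∀ i → T (U i) → T (S i)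
⊆ᵇ-sound {suc m} {U} {S} U⊆S zero with U zero | S zero | U⊆S
... | true  | true  | _  = id
... | false | _     | _  = λ ()
... | true  | false | ()
⊆ᵇ-sound {suc m} U⊆S (suc i) = ⊆ᵇ-sound (proj₂ (to T-∧ U⊆S)) i

⊆ᵇ-full : ∀ {m} (U : Fin m → Bool) → (U ⊆ᵇ λ _ → true) ≡ true
⊆ᵇ-full {zero}  U = refl
⊆ᵇ-full {suc m} U =
  trans (cong (_∧ (U ∘ suc ⊆ᵇ λ _ → true)) (∨-zeroʳ (not (U zero)))) (⊆ᵇ-full (U ∘ suc))

∑-subsets : ∀ m → ℕ → ((Fin m → Bool) → ℕ) → ℕ
∑-subsets zero    zero    h = h (λ ())
∑-subsets zero    (suc k) h = 0
∑-subsets (suc m) zero    h = ∑-subsets m zero (λ U → h (false ∷ U))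
∑-subsets (suc m) (suc k) h =
  ∑-subsets m (suc k) (λ U → h (false ∷ U)) + ∑-subsets m k (λ U → h (true ∷ U))

∑-subsets-mono : ∀ m k {h h′ : (Fin m → Bool) → ℕ} → (∀ U → count U ≡ k → h U ≤ h′ U) →
  ∑-subsets m k h ≤ ∑-subsets m k h′
∑-subsets-mono zero    zero    h≤h′ = h≤h′ _ refl
∑-subsets-mono zero    (suc k) h≤h′ = z≤n
∑-subsets-mono (suc m) zero    h≤h′ = ∑-subsets-mono m zero (h≤h′ ∘ (false ∷_))
∑-subsets-mono (suc m) (suc k) h≤h′ =
  +-mono-≤ (∑-subsets-mono m (suc k) (h≤h′ ∘ (false ∷_)))
           (∑-subsets-mono m k (λ U → h≤h′ (true ∷ U) ∘ cong suc))

∑-subsets-cong : ∀ m k {h h′ : (Fin m → Bool) → ℕ} → (∀ U → h U ≡ h′ U) →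
  ∑-subsets m k h ≡ ∑-subsets m k h′
∑-subsets-cong zero    zero    h≡h′ = h≡h′ _
∑-subsets-cong zero    (suc k) h≡h′ = refl
∑-subsets-cong (suc m) zero    h≡h′ = ∑-subsets-cong m zero (h≡h′ ∘ (false ∷_))
∑-subsets-cong (suc m) (suc k) h≡h′ =
  cong₂ _+_ (∑-subsets-cong m (suc k) (h≡h′ ∘ (false ∷_))) (∑-subsets-cong m k (h≡h′ ∘ (true ∷_)))

*-distribˡ-∑-subsets : ∀ m k x (h : (Fin m → Bool) → ℕ) →
  x * ∑-subsets m k h ≡ ∑-subsets m k (λ U → x * h U)
*-distribˡ-∑-subsets zero    zero    x h = refl
*-distribˡ-∑-subsets zero    (suc k) x h = *-zeroʳ x
*-distribˡ-∑-subsets (suc m) zero    x h = *-distribˡ-∑-subsets m zero x _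
*-distribˡ-∑-subsets (suc m) (suc k) x h =
  trans (*-distribˡ-+ x _ _) (cong₂ _+_ (*-distribˡ-∑-subsets m (suc k) x _) (*-distribˡ-∑-subsets m k x _))

∑-subsets-zero : ∀ m k → ∑-subsets m k (λ _ → 0) ≡ 0
∑-subsets-zero m k = sym (*-distribˡ-∑-subsets m k 0 (λ _ → 0))

∑-subsets-comm-∑ : ∀ m k {n} (h : Fin n → (Fin m → Bool) → ℕ) →
  ∑-subsets m k (λ U → ∑[ j < n ] h j U) ≡ ∑[ j < n ] ∑-subsets m k (h j)
∑-subsets-comm-∑ zero    zero    h = refl
∑-subsets-comm-∑ zero    (suc k) {n} h = sym (sum-replicate-zero n)
∑-subsets-comm-∑ (suc m) zero    h = ∑-subsets-comm-∑ m zero (λ j U → h j (false ∷ U))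
∑-subsets-comm-∑ (suc m) (suc k) h = trans
  (cong₂ _+_ (∑-subsets-comm-∑ m (suc k) (λ j → h j ∘ (false ∷_))) (∑-subsets-comm-∑ m k (λ j → h j ∘ (true ∷_))))
  (sym (∑-distrib-+ (λ j → ∑-subsets m (suc k) (h j ∘ (false ∷_))) (λ j → ∑-subsets m k (h j ∘ (true ∷_)))))

∑-subsets-⊆ : ∀ m k (S : Fin m → Bool) → ∑-subsets m k (λ U → 𝟙 (U ⊆ᵇ S)) ≡ count S C k
∑-subsets-⊆ zero    zero    S = refl
∑-subsets-⊆ zero    (suc k) S = sym (k>n⇒nCk≡0 {0} {suc k} z<s)
∑-subsets-⊆ (suc m) zero    S = ∑-subsets-⊆ m zero (S ∘ suc)
∑-subsets-⊆ (suc m) (suc k) S with S zero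
... | true  = trans (cong₂ _+_ (∑-subsets-⊆ m (suc k) (S ∘ suc)) (∑-subsets-⊆ m k (S ∘ suc)))
                    (trans (+-comm (count (S ∘ suc) C suc k) _) (nCk+nC[k+1]≡[n+1]C[k+1] (count (S ∘ suc)) k))
... | false = trans (cong₂ _+_ (∑-subsets-⊆ m (suc k) (S ∘ suc)) (∑-subsets-zero m k)) (+-identityʳ _)

∑-subsets-∋-empty : ∀ m r (P : (Fin m → Bool) → Bool) → ∑-subsets m 0 (λ U → 𝟙 (U r ∧ P U)) ≡ 0
∑-subsets-∋-empty (suc m) zero    P = ∑-subsets-zero m 0
∑-subsets-∋-empty (suc m) (suc r) P = ∑-subsets-∋-empty m r (P ∘ (false ∷_))

∑-subsets-⊆-∋ : ∀ m k (S : Fin m → Bool) r → T (S r) →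
  ∑-subsets m (suc k) (λ U → 𝟙 (U r ∧ (U ⊆ᵇ S))) ≡ (count S ∸ 1) C k
∑-subsets-⊆-∋ (suc m) k S zero Sᵣ with S zero | Sᵣ
... | true | _ = cong₂ _+_ (∑-subsets-zero m (suc k)) (∑-subsets-⊆ m k (S ∘ suc))
∑-subsets-⊆-∋ (suc m) k S (suc r) Sᵣ with S zero
... | false = trans (cong₂ _+_ (∑-subsets-⊆-∋ m k (S ∘ suc) r Sᵣ) notInS) (+-identityʳ _)
  where
  notInS = trans (∑-subsets-cong m k (λ U → cong 𝟙 (∧-zeroʳ (U r)))) (∑-subsets-zero m k)
∑-subsets-⊆-∋ (suc m) zero    S (suc r) Sᵣ | true =
  cong₂ _+_ (∑-subsets-⊆-∋ m zero (S ∘ suc) r Sᵣ) (∑-subsets-∋-empty m r _)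
∑-subsets-⊆-∋ (suc m) (suc k) S (suc r) Sᵣ | true = trans
  (cong₂ _+_ (∑-subsets-⊆-∋ m (suc k) (S ∘ suc) r Sᵣ) (∑-subsets-⊆-∋ m k (S ∘ suc) r Sᵣ))
  (pascal-pred k (count-pos (S ∘ suc) r Sᵣ))

column : ∀ {m n} → Matrix m n → Fin n → Fin m → Bool
column A j i = A i j

columnOver : ∀ {m n} → Matrix m n → ℕ → (Fin m → Bool) → Fin n → Bool
columnOver A s U j = (colSum A j ≡ᵇ s) ∧ (U ⊆ᵇ column A j)

rowDegree : ∀ {m n} → Matrix m n → ℕ → Fin m → ℕ
rowDegree A s i = count (λ j → (colSum A j ≡ᵇ s) ∧ A i j)

count-∨-any≤ : ∀ {q m} (U : Fin m → Bool) (S : Fin q → Fin m → Bool) →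
  count (λ i → U i ∨ any (λ k → S k i)) ≤ count U + ∑[ k < q ] count (λ i → not (U i) ∧ S k i)
count-∨-any≤ U S = ≤-trans (count-mono covered) (count-any≤∑count (U ∷ λ k i → not (U i) ∧ S k i))
  where
  covered : ∀ i → T (U i ∨ any (λ k → S k i)) → T (U i ∨ any (λ k → not (U i) ∧ S k i))
  covered i with U i
  ... | true  = id
  ... | false = id

count-outside≡1 : ∀ {m t} (U S : Fin m → Bool) → count S ≡ suc t → T (U ⊆ᵇ S) → count U ≡ t →
  count (λ i → not (U i) ∧ S i) ≡ 1
count-outside≡1 {t = t} U S ∣S∣ U⊆S ∣U∣ = +-cancelˡ-≡ t _ _ (begin
  t + count (λ i → not (U i) ∧ S i)
    ≡⟨ cong (_+ _) (trans (sym ∣U∣) (count-cong inside)) ⟩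
  count (λ i → U i ∧ S i) + count (λ i → not (U i) ∧ S i)
    ≡⟨ count-split U S ⟨
  count S ≡⟨ ∣S∣ ⟩
  suc t   ≡⟨ +-comm 1 t ⟩
  t + 1   ∎)
  where
  open ≡-Reasoning
  inside : ∀ i → U i ≡ U i ∧ S i
  inside i with U i in Uᵢ
  ... | false = refl
  ... | true  = sym (to T-≡ (⊆ᵇ-sound U⊆S i (from T-≡ Uᵢ)))

columnsOver⇒≺ : ∀ {t ℓ q m n} (A : Matrix m n) (U : Fin m → Bool) (c : Fin q → Fin n) →
  t + ℓ + q ≤ m → count U ≡ t → Injective _≡_ _≡_ c →
  (∀ k → colSum A (c k) ≡ suc t) → (∀ k → T (U ⊆ᵇ column A (c k))) →
  copiesOnesZeros q t ℓ ≺ A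
columnsOver⇒≺ {t} {ℓ} {q} {m} A U c room ∣U∣ c-inj sums U⊆c = ρ , c , ρ-inj , c-inj , entries
  where
  UandColumns : Fin (suc q) → Fin m → Bool
  UandColumns = U ∷ column A ∘ c

  Z : Fin m → Bool
  Z i = any (λ k → UandColumns k i)

  ∣Z∣≤ : count Z ≤ t + q
  ∣Z∣≤ = begin
    count Z
      ≤⟨ count-∨-any≤ U (column A ∘ c) ⟩
    count U + ∑[ k < q ] count (λ i → not (U i) ∧ A i (c k))
      ≡⟨ cong₂ _+_ ∣U∣ (sum-cong-≗ λ k → count-outside≡1 U (column A (c k)) (sums k) (U⊆c k) ∣U∣) ⟩
    t + ∑[ k < q ] 1
      ≡⟨ cong (t +_) (trans (sym (count≡∑𝟙 {q} (λ _ → true))) (count-true q)) ⟩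
    t + q ∎
    where open ≤-Reasoning

  ℓ≤∣notZ∣ : ℓ ≤ count (λ i → not (Z i))
  ℓ≤∣notZ∣ = +-cancelʳ-≤ (count Z) ℓ _ (begin
    ℓ + count Z                        ≤⟨ +-monoʳ-≤ ℓ ∣Z∣≤ ⟩
    ℓ + (t + q)                        ≡⟨ +-assoc ℓ t q ⟨
    ℓ + t + q                          ≡⟨ cong (_+ q) (+-comm ℓ t) ⟩
    t + ℓ + q                          ≤⟨ room ⟩
    m                                  ≡⟨ count-complement Z ⟨
    count Z + count (λ i → not (Z i))  ≡⟨ +-comm (count Z) _ ⟩
    count (λ i → not (Z i)) + count Z  ∎)
    where open ≤-Reasoning

  ones : Selection U t
  ones = selection U (≤-reflexive (sym ∣U∣))

  zeros : Selection (λ i → not (Z i)) ℓ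
  zeros = selection (λ i → not (Z i)) ℓ≤∣notZ∣

  f = proj₁ ones
  f-inj = proj₁ (proj₂ ones)
  f∈U = proj₂ (proj₂ ones)
  g = proj₁ zeros
  g-inj = proj₁ (proj₂ zeros)
  g∉Z = proj₂ (proj₂ zeros)

  disjoint : ∀ a b → f a ≢ g b
  disjoint a b fa≡gb = subst T (to T-not-≡ (g∉Z b))
    (subst (T ∘ Z) fa≡gb (any-intro (λ k → UandColumns k (f a)) zero (f∈U a)))

  ρ : Fin (t + ℓ) → Fin m
  ρ i = [ f , g ]′ (splitAt t i)

  ρ-inj : Injective _≡_ _≡_ ρ
  ρ-inj {x} {y} ρx≡ρy = begin
    x                      ≡⟨ Fin.join-splitAt t ℓ x ⟨
    join t ℓ (splitAt t x) ≡⟨ cong (join t ℓ) (fg-inj {splitAt t x} {splitAt t y} ρx≡ρy) ⟩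
    join t ℓ (splitAt t y) ≡⟨ Fin.join-splitAt t ℓ y ⟩
    y                      ∎
    where
    open ≡-Reasoning
    fg-inj : Injective _≡_ _≡_ [ f , g ]′
    fg-inj = [,]-injective f-inj g-inj disjoint

  entry : ∀ s k → A ([ f , g ]′ s) (c k) ≡ copiesOnesZeros q t ℓ (join t ℓ s) k
  entry (inj₁ a) k = trans (to T-≡ (⊆ᵇ-sound (U⊆c k) (f a) (f∈U a)))
    (sym (trans (cong (_<ᵇ t) (Fin.toℕ-↑ˡ a ℓ)) (to T-≡ (<⇒<ᵇ (Fin.toℕ<n a)))))
  entry (inj₂ b) k = trans (to T-not-≡ (not-any (λ k → UandColumns k (g b)) (suc k) (g∉Z b)))
    (sym (trans (cong (_<ᵇ t) (Fin.toℕ-↑ʳ t b)) (m+n≮ᵇm t (toℕ b))))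

  entries : ∀ i k → A (ρ i) (c k) ≡ copiesOnesZeros q t ℓ i k
  entries i k =
    trans (entry (splitAt t i) k) (cong (λ i → copiesOnesZeros q t ℓ i k) (Fin.join-splitAt t ℓ i))

columnOver< : ∀ {t ℓ q m n} (A : Matrix m n) → t + ℓ + q ≤ m → ¬ (copiesOnesZeros q t ℓ ≺ A) →
  (U : Fin m → Bool) → count U ≡ t → count (columnOver A (suc t) U) < q
columnOver< {t} {ℓ} {q} A room noConfig U ∣U∣ with q ≤? count (columnOver A (suc t) U)
... | no q≰ = ≰⇒> q≰
... | yes q≤ = contradiction (columnsOver⇒≺ A U c room ∣U∣ c-inj sums U⊆c) noConfig
  where
  chosen = selection (columnOver A (suc t) U) q≤
  c = proj₁ chosen
  c-inj = proj₁ (proj₂ chosen)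
  sums = λ k → ≡ᵇ⇒≡ _ _ (proj₁ (to T-∧ (proj₂ (proj₂ chosen) k)))
  U⊆c = λ k → proj₂ (to T-∧ (proj₂ (proj₂ chosen) k))

rowDegree-bound : ∀ {m n} (A : Matrix m n) k b →
  (∀ U → count U ≡ suc k → count (columnOver A (suc (suc k)) U) ≤ b) →
  ∀ r → rowDegree A (suc (suc k)) r * suc k ≤ b * ((m ∸ 1) C k)
rowDegree-bound {m} {n} A k b fewColumns r = begin
  rowDegree A (suc (suc k)) r * suc k
    ≡⟨ trans (cong (_* suc k) (count≡∑𝟙 e)) (*-distribʳ-sum (suc k) (𝟙 ∘ e)) ⟩
  ∑[ j < n ] (𝟙 (e j) * suc k)
    ≡⟨ sum-cong-≗ perColumn ⟩
  ∑[ j < n ] (𝟙 (e j) * ∑-subsets m (suc k) (through j))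
    ≡⟨ sum-cong-≗ (λ j → *-distribˡ-∑-subsets m (suc k) (𝟙 (e j)) (through j)) ⟩
  ∑[ j < n ] ∑-subsets m (suc k) (λ U → 𝟙 (e j) * through j U)
    ≡⟨ ∑-subsets-comm-∑ m (suc k) (λ j U → 𝟙 (e j) * through j U) ⟨
  ∑-subsets m (suc k) (λ U → ∑[ j < n ] (𝟙 (e j) * through j U))
    ≤⟨ ∑-subsets-mono m (suc k) perSubset ⟩
  ∑-subsets m (suc k) (λ U → b * 𝟙 (U r))
    ≡⟨ *-distribˡ-∑-subsets m (suc k) b (λ U → 𝟙 (U r)) ⟨
  b * ∑-subsets m (suc k) (λ U → 𝟙 (U r))
    ≡⟨ cong (b *_) subsetsThroughRow ⟩
  b * ((m ∸ 1) C k) ∎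
  where
  open ≤-Reasoning
  e : Fin n → Bool
  e j = (colSum A j ≡ᵇ suc (suc k)) ∧ A r j

  through : Fin n → (Fin m → Bool) → ℕ
  through j U = 𝟙 (U r ∧ (U ⊆ᵇ column A j))

  over : (Fin m → Bool) → Fin n → Bool
  over = columnOver A (suc (suc k))

  perColumn : ∀ j → 𝟙 (e j) * suc k ≡ 𝟙 (e j) * ∑-subsets m (suc k) (through j)
  perColumn j with e j in eⱼ
  ... | false = refl
  ... | true  = cong (1 *_) (sym (begin-equality
    ∑-subsets m (suc k) (through j) ≡⟨ ∑-subsets-⊆-∋ m k (column A j) r (proj₂ eⱼ′) ⟩
    (colSum A j ∸ 1) C k            ≡⟨ cong (λ s → (s ∸ 1) C k) (≡ᵇ⇒≡ (colSum A j) _ (proj₁ eⱼ′)) ⟩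
    suc k C k                       ≡⟨ [1+n]Cn≡1+n k ⟩
    suc k                           ∎))
    where eⱼ′ = to T-∧ (from T-≡ eⱼ)

  dropRow : ∀ x y u v → 𝟙 (x ∧ y) * 𝟙 (u ∧ v) ≤ 𝟙 u * 𝟙 (x ∧ v)
  dropRow false _     _     _ = z≤n
  dropRow true  false _     _ = z≤n
  dropRow true  true  false _ = z≤n
  dropRow true  true  true  _ = ≤-refl

  perSubset : ∀ U → count U ≡ suc k → ∑[ j < n ] (𝟙 (e j) * through j U) ≤ b * 𝟙 (U r)
  perSubset U ∣U∣ = begin
    ∑[ j < n ] (𝟙 (e j) * through j U)
      ≤⟨ ∑-mono-≤ (λ j → dropRow (colSum A j ≡ᵇ suc (suc k)) (A r j) (U r) _) ⟩
    ∑[ j < n ] (𝟙 (U r) * 𝟙 (over U j))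
      ≡⟨ trans (cong (𝟙 (U r) *_) (count≡∑𝟙 (over U))) (*-distribˡ-sum (𝟙 (U r)) (𝟙 ∘ over U)) ⟨
    𝟙 (U r) * count (over U)
      ≤⟨ *-monoʳ-≤ (𝟙 (U r)) (fewColumns U ∣U∣) ⟩
    𝟙 (U r) * b
      ≡⟨ *-comm (𝟙 (U r)) b ⟩
    b * 𝟙 (U r) ∎

  throughFull : ∀ U → 𝟙 (U r) ≡ 𝟙 (U r ∧ (U ⊆ᵇ λ _ → true))
  throughFull U = cong 𝟙 (trans (sym (∧-identityʳ (U r))) (cong (U r ∧_) (sym (⊆ᵇ-full U))))

  subsetsThroughRow : ∑-subsets m (suc k) (λ U → 𝟙 (U r)) ≡ (m ∸ 1) C k
  subsetsThroughRow = begin-equality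
    ∑-subsets m (suc k) (λ U → 𝟙 (U r))
      ≡⟨ ∑-subsets-cong m (suc k) throughFull ⟩
    ∑-subsets m (suc k) (λ U → 𝟙 (U r ∧ (U ⊆ᵇ λ _ → true)))
      ≡⟨ ∑-subsets-⊆-∋ m k (λ _ → true) r _ ⟩
    (count {m} (λ _ → true) ∸ 1) C k
      ≡⟨ cong (λ s → (s ∸ 1) C k) (count-true m) ⟩
    (m ∸ 1) C k ∎

normAR≤∑rowDegree : ∀ {m n} (A : Matrix m n) s (R : Subset m) →
  normAR A s R ≤ ∑[ i < m ] (𝟙 (Vec.lookup R i) * rowDegree A (suc s) i)
normAR≤∑rowDegree {m} A s R = begin
  normAR A s R
    ≤⟨ count-mono distribute ⟩
  count (λ j → any (λ i → Vec.lookup R i ∧ ((colSum A j ≡ᵇ suc s) ∧ A i j)))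
    ≤⟨ count-any≤∑count (λ i j → Vec.lookup R i ∧ ((colSum A j ≡ᵇ suc s) ∧ A i j)) ⟩
  ∑[ i < m ] count (λ j → Vec.lookup R i ∧ ((colSum A j ≡ᵇ suc s) ∧ A i j))
    ≡⟨ sum-cong-≗ (λ i → count-∧ˡ (Vec.lookup R i) (λ j → (colSum A j ≡ᵇ suc s) ∧ A i j)) ⟩
  ∑[ i < m ] (𝟙 (Vec.lookup R i) * rowDegree A (suc s) i) ∎
  where
  open ≤-Reasoning
  distribute : ∀ j → T ((colSum A j ≡ᵇ suc s) ∧ any (λ i → Vec.lookup R i ∧ A i j)) →
    T (any (λ i → Vec.lookup R i ∧ ((colSum A j ≡ᵇ suc s) ∧ A i j)))
  distribute j with colSum A j ≡ᵇ suc s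
  ... | true = id

∣∣≡count : ∀ {m} (R : Subset m) → ∣ R ∣ ≡ count (Vec.lookup R)
∣∣≡count Vec.[]            = refl
∣∣≡count (true Vec.∷ R)  = cong suc (∣∣≡count R)
∣∣≡count (false Vec.∷ R) = ∣∣≡count R

-- Only t ≥ 1 (from ℓ < t), the room m > t+ℓ+λ′+2 and the forbidden configuration are used.
lemma6 : (t ℓ λ′ m n : ℕ) → ℓ < t → 1 ≤ λ′ → t + ℓ + λ′ + 2 < m →
    (A : Matrix m n) →
    ¬ (copiesOnesZeros (λ′ + 2) t ℓ ≺ A) →
    (∀ j → t ≤ colSum A j × colSum A j ≤ m ∸ ℓ) →
    (∀ j k → j ≢ k → colSum A j ≡ t → ¬ (∀ i → A i j ≡ A i k)) →
    (R : Subset m) →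
    normAR A t R * t ≤ ∣ R ∣ * (λ′ + 1) * ((m ∸ 1) C (t ∸ 1))
lemma6 zero ℓ λ′ m n () _ _ _ _ _ _ _
lemma6 (suc k) ℓ λ′ m n _ _ room A noConfig _ _ R = begin
  normAR A (suc k) R * suc k
    ≤⟨ *-monoˡ-≤ (suc k) (normAR≤∑rowDegree A (suc k) R) ⟩
  (∑[ i < m ] (w i * d i)) * suc k
    ≡⟨ *-distribʳ-sum (suc k) (λ i → w i * d i) ⟩
  ∑[ i < m ] (w i * d i * suc k)
    ≤⟨ ∑-mono-≤ (λ i → ≤-trans (≤-reflexive (*-assoc (w i) (d i) (suc k))) (*-monoʳ-≤ (w i) (d*t≤X i))) ⟩
  ∑[ i < m ] (w i * X)
    ≡⟨ trans (cong (_* X) (trans (∣∣≡count R) (count≡∑𝟙 (Vec.lookup R)))) (*-distribʳ-sum X w) ⟨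
  ∣ R ∣ * X
    ≡⟨ *-assoc ∣ R ∣ (λ′ + 1) _ ⟨
  ∣ R ∣ * (λ′ + 1) * ((m ∸ 1) C k) ∎
  where
  open ≤-Reasoning
  w = 𝟙 ∘ Vec.lookup R
  d = rowDegree A (suc (suc k))
  X = (λ′ + 1) * ((m ∸ 1) C k)

  room′ : suc k + ℓ + (λ′ + 2) ≤ m
  room′ = ≤-trans (≤-reflexive (sym (+-assoc (suc k + ℓ) λ′ 2))) (≤-trans (n≤1+n _) room)

  fewColumns : ∀ U → count U ≡ suc k → count (columnOver A (suc (suc k)) U) ≤ λ′ + 1
  fewColumns U ∣U∣ = s≤s⁻¹ (≤-trans (columnOver< A room′ noConfig U ∣U∣) (≤-reflexive (+-suc λ′ 1)))

  d*t≤X : ∀ i → d i * suc k ≤ X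
  d*t≤X = rowDegree-bound A k (λ′ + 1) fewColumns
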